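{- Fix $0<p\le1/2$. Let ${\bf x}_1,\dots,{\bf x}_m$ be independent random vectors in $\{0,1,-1\}^n$, each with independent entries distributed according to $\mu_p$. Then the probability that there exist distinct integers $i_1,j_1,i_2,j_2,\dots,i_m,j_m\in[n]$ with $({\bf x}_k)_{i_k}=1$ and $({\bf x}_k)_{j_k}=-1$ for all $k\in[m]$ is at least \[ 1-\frac1p(1-p)^{n-2m+1}. \]
   Context: $\mu_p$ is the distribution on $\{0,1,-1\}$ with $\mu_p(1)=\mu_p(-1)=p$ and $\mu_p(0)=1-2p$. $[n]=\{1,\dots,n\}$.
   Formalization: The parameter p of $\mu_p$ takes only rational values in (0, 1/2]. -}

module Defs where

open import Data.Nat as ℕ using (ℕ; zero; suc)
open import Data.Integer as ℤ using (ℤ; +_; -[1+_])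
open import Data.Rational as ℚ using (ℚ; 0ℚ; 1ℚ; _+_; _*_; _-_; 1/_; _≟_; ≢-nonZero)
open import Data.Fin using (Fin)
open import Data.Vec using (Vec; []; _∷_; lookup)
open import Data.List as List using (List; []; _∷_; concatMap; map; filter; foldr)
open import Data.Product using (Σ; _×_; _,_)
open import Relation.Nullary using (¬_; yes; no)
open import Relation.Unary using (Pred; Decidable)
import Level
open import Relation.Binary.PropositionalEquality using (_≡_)
open import Function.Definitions using (Injective)

data Trit : Set where
  t0 t1 t-1 : Trit

μ : ℚ → Trit → ℚ
μ p t0  = 1ℚ - (p + p)
μ p t1  = p
μ p t-1 = p

_^ℕ_ : ℚ → ℕ → ℚ
q ^ℕ zero  = 1ℚ
q ^ℕ suc k = q * (q ^ℕ k)

-- integer powers in ℚ (value at q = 0 with negative exponent is irrelevant; set to 0)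
_^ℤ_ : ℚ → ℤ → ℚ
q ^ℤ (+ k) = q ^ℕ k
q ^ℤ -[1+ k ] with q ^ℕ suc k ≟ 0ℚ
... | yes _  = 0ℚ
... | no q≢0 = 1/_ (q ^ℕ suc k) {{≢-nonZero q≢0}}

sumℚ : List ℚ → ℚ
sumℚ = foldr _+_ 0ℚ

allVecs : (n : ℕ) → List (Vec Trit n)
allVecs zero    = [] ∷ []
allVecs (suc n) = concatMap (λ v → map (_∷ v) (t0 ∷ t1 ∷ t-1 ∷ [])) (allVecs n)

allTuples : (m n : ℕ) → List (Vec (Vec Trit n) m)
allTuples zero    n = [] ∷ []
allTuples (suc m) n = concatMap (λ xs → map (_∷ xs) (allVecs n)) (allTuples m n)

probVec : ℚ → {n : ℕ} → Vec Trit n → ℚ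
probVec p []       = 1ℚ
probVec p (t ∷ ts) = μ p t * probVec p ts

probTuple : ℚ → {m n : ℕ} → Vec (Vec Trit n) m → ℚ
probTuple p []       = 1ℚ
probTuple p (x ∷ xs) = probVec p x * probTuple p xs

Prob : (p : ℚ) (m n : ℕ) {E : Pred (Vec (Vec Trit n) m) Level.zero} → Decidable E → ℚ
Prob p m n d = sumℚ (map (probTuple p) (filter d (allTuples m n)))

-- The event: there exist distinct i_1,j_1,…,i_m,j_m ∈ [n] with (x_k)_{i_k} = 1, (x_k)_{j_k} = -1.
-- Distinctness of all 2m indices: i injective, j injective, and i_k ≠ j_l for all k, l.
Event : (m n : ℕ) → Vec (Vec Trit n) m → Set
Event m n xs =
  Σ (Fin m → Fin n) λ i → Σ (Fin m → Fin n) λ j →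
    Injective _≡_ _≡_ i × Injective _≡_ _≡_ j × (∀ k l → ¬ (i k ≡ j l)) ×
    (∀ k → lookup (lookup xs k) (i k) ≡ t1) × (∀ k → lookup (lookup xs k) (j k) ≡ t-1)

{-# OPTIONS --safe #-}

-- Match the vectors greedily, one at a time, against a set F of still unused
-- coordinates (initially all of [n]): take the first coordinate of F where the
-- vector is 1 and the first where it is -1, and remove both from F.  After k successful steps |F| = n - 2k,
-- and F does not depend on the next vector, so that step fails with probability
-- at most 2(1-p)^(n-2k).  Hence p·P(failure) ≤ Σ_{k<m} 2p(1-p)^(n-2k), which
-- telescopes to at most (1-p)^(n-2m+1) because (1-p)² + 2p(1-p) ≤ 1.  When
-- n - 2m + 1 ≤ 0 the bound is trivial.
module Submission where

open import Defs
open import Data.Nat using (ℕ)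
open import Data.Integer using (+_)
open import Data.Integer using () renaming (_-_ to _-ℤ_; _+_ to _+ℤ_; _*_ to _*ℤ_)
open import Data.Rational using (ℚ; 0ℚ; 1ℚ; ½; _<_; _≤_; _-_; _*_; _÷_; >-nonZero)
open import Relation.Unary using (Decidable)

open import Data.Bool using (Bool; true; false; not)
open import Data.Empty using (⊥-elim)
open import Data.Fin using (Fin; zero; suc)
open import Data.Fin.Subset using (Subset; inside; outside; _∈_; _∉_; ∣_∣; ⊤; ⁅_⁆) renaming (_-_ to _∖_)
open import Data.Fin.Subset.Properties using (p─⊥≡p; p─q⊆p; x∈p∧x≢y⇒x∈p-y; ∣⊤∣≡n)
open import Data.Integer using (-[1+_])
import Data.Integer.Properties as ℤP
import Data.Integer.Solver as ℤSolver
open import Data.List using (List; []; _∷_; _++_; map; concatMap; filter)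
open import Data.Maybe as Maybe using (Maybe; just; nothing; is-nothing; _>>=_)
open import Data.Nat as ℕ using (zero; suc)
import Data.Nat.Properties as ℕP
open import Data.Nat.Tactic.RingSolver using (solve-∀)
open import Data.Product using (∃; _×_; _,_)
open import Data.Rational as ℚ using (_+_; -_; 1/_; _≟_; Positive)
import Data.Rational.Properties as ℚP
open import Data.Rational.Solver using (module +-*-Solver)
open import Data.Vec using (Vec; []; _∷_; lookup; here; there)
import Data.Vec.Functional as VF
open import Function using (_∘_)
open import Function.Definitions using (Injective)
open import Relation.Binary.Definitions using (DecidableEquality)
open import Relation.Binary.PropositionalEquality
open import Relation.Nullary using (yes; no; does)

open +-*-Solver

private
  variable
    A B C : Set
    m n : ℕ

-- Sums and expectations over lists

sumOver : List A → (A → ℚ) → ℚ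
sumOver L f = sumℚ (map f L)

sumOver-cong : ∀ (L : List A) {f g : A → ℚ} → (∀ x → f x ≡ g x) → sumOver L f ≡ sumOver L g
sumOver-cong []      f≡g = refl
sumOver-cong (x ∷ L) f≡g = cong₂ _+_ (f≡g x) (sumOver-cong L f≡g)

sumOver-+ : ∀ (L : List A) (f g : A → ℚ) → sumOver L (λ x → f x + g x) ≡ sumOver L f + sumOver L g
sumOver-+ []      f g = refl
sumOver-+ (x ∷ L) f g = trans (cong (_+_ (f x + g x)) (sumOver-+ L f g))
  (solve 4 (λ a b c d → (a :+ b) :+ (c :+ d) := (a :+ c) :+ (b :+ d)) refl
           (f x) (g x) (sumOver L f) (sumOver L g))

sumOver-*ˡ : ∀ (L : List A) (c : ℚ) (f : A → ℚ) → sumOver L (λ x → c * f x) ≡ c * sumOver L f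
sumOver-*ˡ []      c f = sym (ℚP.*-zeroʳ c)
sumOver-*ˡ (x ∷ L) c f = trans (cong (_+_ (c * f x)) (sumOver-*ˡ L c f))
                               (sym (ℚP.*-distribˡ-+ c (f x) (sumOver L f)))

sumOver-mono : ∀ (L : List A) {f g : A → ℚ} → (∀ x → f x ≤ g x) → sumOver L f ≤ sumOver L g
sumOver-mono []      f≤g = ℚP.≤-refl
sumOver-mono (x ∷ L) f≤g = ℚP.+-mono-≤ (f≤g x) (sumOver-mono L f≤g)

sumOver-++ : ∀ (L L′ : List A) (f : A → ℚ) → sumOver (L ++ L′) f ≡ sumOver L f + sumOver L′ f
sumOver-++ []      L′ f = sym (ℚP.+-identityˡ _)
sumOver-++ (x ∷ L) L′ f = trans (cong (_+_ (f x)) (sumOver-++ L L′ f))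
                                (sym (ℚP.+-assoc (f x) (sumOver L f) (sumOver L′ f)))

sumOver-concatMap : ∀ (h : A → List B) (L : List A) (f : B → ℚ) →
                    sumOver (concatMap h L) f ≡ sumOver L (λ a → sumOver (h a) f)
sumOver-concatMap h []      f = refl
sumOver-concatMap h (a ∷ L) f = trans (sumOver-++ (h a) (concatMap h L) f)
                                      (cong (_+_ (sumOver (h a) f)) (sumOver-concatMap h L f))

sumOver-map : ∀ (g : A → B) (L : List A) (f : B → ℚ) → sumOver (map g L) f ≡ sumOver L (f ∘ g)
sumOver-map g []      f = refl
sumOver-map g (x ∷ L) f = cong (_+_ (f (g x))) (sumOver-map g L f)

𝟙 : Bool → ℚ
𝟙 true  = 1ℚ
𝟙 false = 0ℚ

𝟙-nonNeg : ∀ b → 0ℚ ≤ 𝟙 b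
𝟙-nonNeg true  = ℚP.≤ᵇ⇒≤ _
𝟙-nonNeg false = ℚP.≤-refl

𝟙≤1 : ∀ b → 𝟙 b ≤ 1ℚ
𝟙≤1 true  = ℚP.≤-refl
𝟙≤1 false = ℚP.≤ᵇ⇒≤ _

expect : (A → ℚ) → List A → (A → ℚ) → ℚ
expect w L f = sumOver L (λ x → w x * f x)

module _ (w : A → ℚ) (L : List A) where

  expect-cong : {f g : A → ℚ} → (∀ x → f x ≡ g x) → expect w L f ≡ expect w L g
  expect-cong f≡g = sumOver-cong L (λ x → cong (w x *_) (f≡g x))

  expect-+ : ∀ f g → expect w L (λ x → f x + g x) ≡ expect w L f + expect w L g
  expect-+ f g = trans (sumOver-cong L (λ x → ℚP.*-distribˡ-+ (w x) (f x) (g x))) (sumOver-+ L _ _)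

  expect-*ˡ : ∀ c f → expect w L (λ x → c * f x) ≡ c * expect w L f
  expect-*ˡ c f = trans (sumOver-cong L (λ x → reorder (w x) c (f x))) (sumOver-*ˡ L c _)
    where
    reorder : ∀ x y z → x * (y * z) ≡ y * (x * z)
    reorder = solve 3 (λ x y z → x :* (y :* z) := y :* (x :* z)) refl

  expect-*ʳ : ∀ f c → expect w L (λ x → f x * c) ≡ expect w L f * c
  expect-*ʳ f c = trans (expect-cong (λ x → ℚP.*-comm (f x) c)) (trans (expect-*ˡ c f) (ℚP.*-comm c _))

  expect-const : expect w L (λ _ → 1ℚ) ≡ 1ℚ → ∀ c → expect w L (λ _ → c) ≡ c
  expect-const total c = begin
    expect w L (λ _ → c)          ≡⟨ expect-cong (λ _ → sym (ℚP.*-identityʳ c)) ⟩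
    expect w L (λ _ → c * 1ℚ)     ≡⟨ expect-*ˡ c (λ _ → 1ℚ) ⟩
    c * expect w L (λ _ → 1ℚ)     ≡⟨ cong (c *_) total ⟩
    c * 1ℚ                        ≡⟨ ℚP.*-identityʳ c ⟩
    c                             ∎
    where open ≡-Reasoning

  expect-mono : (∀ x → 0ℚ ≤ w x) → {f g : A → ℚ} → (∀ x → f x ≤ g x) → expect w L f ≤ expect w L g
  expect-mono w≥0 f≤g = sumOver-mono L (λ x → ℚP.*-monoˡ-≤-nonNeg (w x) {{ℚ.nonNegative (w≥0 x)}} (f≤g x))

expect-product : ∀ (_∙_ : A → B → C) (wA : A → ℚ) (wB : B → ℚ) (wC : C → ℚ) →
                 (∀ a b → wC (a ∙ b) ≡ wA a * wB b) → ∀ LA LB f →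
                 expect wC (concatMap (λ b → map (_∙ b) LA) LB) f ≡
                 expect wB LB (λ b → expect wA LA (λ a → f (a ∙ b)))
expect-product _∙_ wA wB wC w∙ LA LB f = begin
  expect wC (concatMap (λ b → map (_∙ b) LA) LB) f
    ≡⟨ sumOver-concatMap (λ b → map (_∙ b) LA) LB _ ⟩
  sumOver LB (λ b → sumOver (map (_∙ b) LA) (λ c → wC c * f c))
    ≡⟨ sumOver-cong LB (λ b → sumOver-map (_∙ b) LA _) ⟩
  sumOver LB (λ b → sumOver LA (λ a → wC (a ∙ b) * f (a ∙ b)))
    ≡⟨ sumOver-cong LB (λ b → sumOver-cong LA (λ a → cong (_* f (a ∙ b)) (w∙ a b))) ⟩
  sumOver LB (λ b → sumOver LA (λ a → wA a * wB b * f (a ∙ b)))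
    ≡⟨ sumOver-cong LB (λ b → trans (sumOver-cong LA (λ a → reorder (wA a) (wB b) (f (a ∙ b))))
                                     (sumOver-*ˡ LA (wB b) _)) ⟩
  expect wB LB (λ b → expect wA LA (λ a → f (a ∙ b)))
    ∎
  where
  open ≡-Reasoning
  reorder : ∀ x y z → x * y * z ≡ y * (x * z)
  reorder = solve 3 (λ x y z → x :* y :* z := y :* (x :* z)) refl

sumℚ-filter≡expect-𝟙 : ∀ (w : A → ℚ) {P : A → Set} (P? : Decidable P) (L : List A) →
                       sumℚ (map w (filter P? L)) ≡ expect w L (λ x → 𝟙 (does (P? x)))
sumℚ-filter≡expect-𝟙 w P? []      = refl
sumℚ-filter≡expect-𝟙 w P? (x ∷ L) with does (P? x)
... | true  = cong₂ _+_ (sym (ℚP.*-identityʳ (w x))) (sumℚ-filter≡expect-𝟙 w P? L)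
... | false = trans (sumℚ-filter≡expect-𝟙 w P? L)
  (sym (trans (cong (_+ sumOver L _) (ℚP.*-zeroʳ (w x))) (ℚP.+-identityˡ _)))

p≤q⇒0≤q-p : ∀ {a b} → a ≤ b → 0ℚ ≤ b - a
p≤q⇒0≤q-p {a} {b} a≤b = subst (_≤ b - a) (ℚP.+-inverseʳ a) (ℚP.+-monoˡ-≤ (- a) a≤b)

0≤q-p⇒p≤q : ∀ {a b} → 0ℚ ≤ b - a → a ≤ b
0≤q-p⇒p≤q {a} {b} 0≤b-a = subst₂ _≤_ (ℚP.+-identityʳ a) (solve 2 (λ a b → a :+ (b :- a) := b) refl a b)
  (ℚP.+-monoʳ-≤ a 0≤b-a)

0≤* : ∀ {a b} → 0ℚ ≤ a → 0ℚ ≤ b → 0ℚ ≤ a * b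
0≤* {a} {b} 0≤a 0≤b =
  ℚP.nonNegative⁻¹ _ {{ℚP.nonNeg*nonNeg⇒nonNeg a {{ℚ.nonNegative 0≤a}} b {{ℚ.nonNegative 0≤b}}}}

p≤p+q : ∀ {a b} → 0ℚ ≤ b → a ≤ a + b
p≤p+q {a} {b} 0≤b = subst (_≤ a + b) (ℚP.+-identityʳ a) (ℚP.+-monoʳ-≤ a 0≤b)

p≤q+r∧r≤s⇒p-s≤q : ∀ {a b c d} → a ≤ b + c → c ≤ d → a - d ≤ b
p≤q+r∧r≤s⇒p-s≤q {a} {b} {c} {d} a≤b+c c≤d = begin
  a - d        ≤⟨ ℚP.+-monoʳ-≤ a (ℚP.neg-antimono-≤ c≤d) ⟩
  a - c        ≤⟨ ℚP.+-monoˡ-≤ (- c) a≤b+c ⟩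
  b + c - c    ≡⟨ solve 2 (λ b c → b :+ c :- c := b) refl b c ⟩
  b            ∎
  where open ℚP.≤-Reasoning

*≤⇒≤÷ : ∀ {a b} c .{{_ : Positive c}} → c * a ≤ b → a ≤ (b ÷ c) {{ℚP.pos⇒nonZero c}}
*≤⇒≤÷ {a} {b} c c*a≤b = ℚP.*-cancelˡ-≤-pos c (ℚP.≤-trans c*a≤b (ℚP.≤-reflexive (sym c*[b÷c]≡b)))
  where
  open ≡-Reasoning
  u = (1/ c) {{ℚP.pos⇒nonZero c}}
  c*[b÷c]≡b : c * (b * u) ≡ b
  c*[b÷c]≡b = begin
    c * (b * u)  ≡⟨ solve 3 (λ b c u → c :* (b :* u) := b :* (c :* u)) refl b c u ⟩
    b * (c * u)  ≡⟨ cong (b *_) (ℚP.*-inverseʳ c {{ℚP.pos⇒nonZero c}}) ⟩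
    b * 1ℚ       ≡⟨ ℚP.*-identityʳ b ⟩
    b            ∎

module _ {a : ℚ} where

  ^ℕ-nonNeg : 0ℚ ≤ a → ∀ k → 0ℚ ≤ a ^ℕ k
  ^ℕ-nonNeg 0≤a zero    = ℚP.≤ᵇ⇒≤ _
  ^ℕ-nonNeg 0≤a (suc k) = 0≤* 0≤a (^ℕ-nonNeg 0≤a k)

  ^ℕ-pos : 0ℚ < a → ∀ k → 0ℚ < a ^ℕ k
  ^ℕ-pos 0<a zero    = ℚP.positive⁻¹ 1ℚ
  ^ℕ-pos 0<a (suc k) =
    ℚP.positive⁻¹ _ {{ℚP.pos*pos⇒pos a {{ℚ.positive 0<a}} _ {{ℚ.positive (^ℕ-pos 0<a k)}}}}

  ^ℕ-≤1 : 0ℚ ≤ a → a ≤ 1ℚ → ∀ k → a ^ℕ k ≤ 1ℚ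
  ^ℕ-≤1 0≤a a≤1 zero    = ℚP.≤-refl
  ^ℕ-≤1 0≤a a≤1 (suc k) = begin
    a * a ^ℕ k   ≤⟨ ℚP.*-monoʳ-≤-nonNeg (a ^ℕ k) {{ℚ.nonNegative (^ℕ-nonNeg 0≤a k)}} a≤1 ⟩
    1ℚ * a ^ℕ k  ≡⟨ ℚP.*-identityˡ _ ⟩
    a ^ℕ k       ≤⟨ ^ℕ-≤1 0≤a a≤1 k ⟩
    1ℚ           ∎
    where open ℚP.≤-Reasoning

  1≤^ℤ-[1+] : 0ℚ < a → a ≤ 1ℚ → ∀ k → 1ℚ ≤ a ^ℤ -[1+ k ]
  1≤^ℤ-[1+] 0<a a≤1 k with a ^ℕ suc k ≟ 0ℚ
  ... | yes aᵏ⁺¹≡0 = ⊥-elim (ℚP.<-irrefl (sym aᵏ⁺¹≡0) (^ℕ-pos 0<a (suc k)))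
  ... | no  _      = ℚP.≤-trans (*≤⇒≤÷ (a ^ℕ suc k) {{ℚ.positive (^ℕ-pos 0<a (suc k))}} aᵏ⁺¹*1≤1)
                                (ℚP.≤-reflexive (ℚP.*-identityˡ _))
    where
    aᵏ⁺¹*1≤1 : a ^ℕ suc k * 1ℚ ≤ 1ℚ
    aᵏ⁺¹*1≤1 = subst (_≤ 1ℚ) (sym (ℚP.*-identityʳ _)) (^ℕ-≤1 (ℚP.<⇒≤ 0<a) a≤1 (suc k))

exponent-suc : ∀ {m n r} → (+ n -ℤ (+ 2 *ℤ + m)) +ℤ + 1 ≡ + suc r → 2 ℕ.* m ℕ.+ r ≡ n
exponent-suc {m} {n} {r} e = sym (ℤP.+-injective (begin
  + n
    ≡⟨ ℤS.solve 2 (λ x a → x ℤS.:= x ℤS.:- a ℤS.:+ ℤS.con (+ 1) ℤS.:+ a ℤS.:- ℤS.con (+ 1)) refl (+ n) a ⟩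
  (+ n -ℤ a) +ℤ + 1 +ℤ a -ℤ + 1
    ≡⟨ cong (λ z → z +ℤ a -ℤ + 1) e ⟩
  + suc r +ℤ a -ℤ + 1
    ≡⟨ ℤS.solve 2 (λ r a → ℤS.con (+ 1) ℤS.:+ r ℤS.:+ a ℤS.:- ℤS.con (+ 1) ℤS.:= a ℤS.:+ r) refl (+ r) a ⟩
  a +ℤ + r
    ≡⟨ cong (_+ℤ + r) (sym (ℤP.pos-* 2 m)) ⟩
  + (2 ℕ.* m ℕ.+ r)
    ∎))
  where
  open ≡-Reasoning
  module ℤS = ℤSolver.+-*-Solver
  a = + 2 *ℤ + m

2[1+m]+r≡2m+[2+r] : ∀ m r → 2 ℕ.* suc m ℕ.+ r ≡ 2 ℕ.* m ℕ.+ suc (suc r)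
2[1+m]+r≡2m+[2+r] = solve-∀

x∉p-x : ∀ (p : Subset n) x → x ∉ p ∖ x
x∉p-x (_ ∷ p) zero    ()
x∉p-x (_ ∷ p) (suc x) (there x∈p-x) = x∉p-x p x x∈p-x

x∈p⇒suc∣p-x∣≡∣p∣ : ∀ {p : Subset n} {x} → x ∈ p → suc ∣ p ∖ x ∣ ≡ ∣ p ∣
x∈p⇒suc∣p-x∣≡∣p∣ {p = inside ∷ p}  here        = cong (suc ∘ ∣_∣) (p─⊥≡p p)
x∈p⇒suc∣p-x∣≡∣p∣ {p = inside ∷ p}  (there x∈p) = cong suc (x∈p⇒suc∣p-x∣≡∣p∣ x∈p)
x∈p⇒suc∣p-x∣≡∣p∣ {p = outside ∷ p} (there x∈p) = x∈p⇒suc∣p-x∣≡∣p∣ x∈p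

p-x-y⊆p : ∀ (p : Subset n) x y {z} → z ∈ p ∖ x ∖ y → z ∈ p
p-x-y⊆p p x y = p─q⊆p p ⁅ x ⁆ ∘ p─q⊆p (p ∖ x) ⁅ y ⁆

∈∧∉⇒≢ : ∀ {p : Subset n} {x y} → x ∈ p → y ∉ p → x ≢ y
∈∧∉⇒≢ x∈p y∉p refl = y∉p x∈p

cons-injective : ∀ {a : A} {f : Fin m → A} → Injective _≡_ _≡_ f → (∀ k → f k ≢ a) →
                 Injective _≡_ _≡_ (a VF.∷ f)
cons-injective f-inj a∉f {zero}  {zero}  _    = refl
cons-injective f-inj a∉f {zero}  {suc l} a≡fl = ⊥-elim (a∉f l (sym a≡fl))
cons-injective f-inj a∉f {suc k} {zero}  fk≡a = ⊥-elim (a∉f k fk≡a)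
cons-injective f-inj a∉f {suc k} {suc l} fk≡fl = cong suc (f-inj fk≡fl)

-- Greedy matching

_≟ᵗ_ : DecidableEquality Trit
t0  ≟ᵗ t0  = yes refl
t0  ≟ᵗ t1  = no λ ()
t0  ≟ᵗ t-1 = no λ ()
t1  ≟ᵗ t0  = no λ ()
t1  ≟ᵗ t1  = yes refl
t1  ≟ᵗ t-1 = no λ ()
t-1 ≟ᵗ t0  = no λ ()
t-1 ≟ᵗ t1  = no λ ()
t-1 ≟ᵗ t-1 = yes refl

Occurrence : Trit → Subset n → Vec Trit n → Set
Occurrence t A x = ∃ λ i → i ∈ A × lookup x i ≡ t

occurrence-suc : ∀ {t a y} {A : Subset n} {x} → Occurrence t A x → Occurrence t (a ∷ A) (y ∷ x)
occurrence-suc (i , i∈A , xᵢ≡t) = suc i , there i∈A , xᵢ≡t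

find : ∀ t (A : Subset n) (x : Vec Trit n) → Maybe (Occurrence t A x)
find t []            []      = nothing
find t (outside ∷ A) (y ∷ x) = Maybe.map occurrence-suc (find t A x)
find t (inside ∷ A)  (y ∷ x) with y ≟ᵗ t
... | yes y≡t = just (zero , here , y≡t)
... | no  _   = Maybe.map occurrence-suc (find t A x)

record Matching {m n} (xs : Vec (Vec Trit n) m) : Set where
  field
    free          : Subset n
    pos neg       : Fin m → Fin n
    pos-injective : Injective _≡_ _≡_ pos
    neg-injective : Injective _≡_ _≡_ neg
    pos≢neg       : ∀ k l → pos k ≢ neg l
    pos-value     : ∀ k → lookup (lookup xs k) (pos k) ≡ t1
    neg-value     : ∀ k → lookup (lookup xs k) (neg k) ≡ t-1
    pos-used      : ∀ k → pos k ∉ free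
    neg-used      : ∀ k → neg k ∉ free
    free-size     : 2 ℕ.* m ℕ.+ ∣ free ∣ ≡ n

matching⇒event : {xs : Vec (Vec Trit n) m} → Matching xs → Event m n xs
matching⇒event M = pos , neg , pos-injective , neg-injective , pos≢neg , pos-value , neg-value
  where open Matching M

emptyMatching : Matching {n = n} []
emptyMatching {n} = record
  { free = ⊤ ; pos = λ () ; neg = λ ()
  ; pos-injective = λ { {()} } ; neg-injective = λ { {()} } ; pos≢neg = λ ()
  ; pos-value = λ () ; neg-value = λ () ; pos-used = λ () ; neg-used = λ ()
  ; free-size = ∣⊤∣≡n n
  }

extend : {x : Vec Trit n} {xs : Vec (Vec Trit n) m} (M : Matching xs) →
         Occurrence t1 (Matching.free M) x → Occurrence t-1 (Matching.free M) x → Matching (x ∷ xs)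
extend {n} {m} {x} M (i , i∈F , xᵢ≡1) (j , j∈F , xⱼ≡-1) = record
  { free          = F ∖ i ∖ j
  ; pos           = i VF.∷ pos
  ; neg           = j VF.∷ neg
  ; pos-injective = cons-injective pos-injective (λ k → ≢-sym (∈∧∉⇒≢ i∈F (pos-used k)))
  ; neg-injective = cons-injective neg-injective (λ k → ≢-sym (∈∧∉⇒≢ j∈F (neg-used k)))
  ; pos≢neg       = pos≢neg′
  ; pos-value     = λ { zero → xᵢ≡1 ; (suc k) → pos-value k }
  ; neg-value     = λ { zero → xⱼ≡-1 ; (suc k) → neg-value k }
  ; pos-used      = λ { zero → x∉p-x F i ∘ p─q⊆p (F ∖ i) ⁅ j ⁆ ; (suc k) → pos-used k ∘ p-x-y⊆p F i j }
  ; neg-used      = λ { zero → x∉p-x (F ∖ i) j ; (suc k) → neg-used k ∘ p-x-y⊆p F i j }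
  ; free-size     = free-size′
  }
  where
  open Matching M renaming (free to F)

  i≢j : i ≢ j
  i≢j refl with trans (sym xᵢ≡1) xⱼ≡-1
  ... | ()

  pos≢neg′ : ∀ k l → (i VF.∷ pos) k ≢ (j VF.∷ neg) l
  pos≢neg′ zero    zero    = i≢j
  pos≢neg′ zero    (suc l) = ∈∧∉⇒≢ i∈F (neg-used l)
  pos≢neg′ (suc k) zero    = ≢-sym (∈∧∉⇒≢ j∈F (pos-used k))
  pos≢neg′ (suc k) (suc l) = pos≢neg k l

  free-size′ : 2 ℕ.* suc m ℕ.+ ∣ F ∖ i ∖ j ∣ ≡ n
  free-size′ = begin
    2 ℕ.* suc m ℕ.+ ∣ F ∖ i ∖ j ∣        ≡⟨ 2[1+m]+r≡2m+[2+r] m _ ⟩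
    2 ℕ.* m ℕ.+ suc (suc ∣ F ∖ i ∖ j ∣)  ≡⟨ cong (λ c → 2 ℕ.* m ℕ.+ suc c) (x∈p⇒suc∣p-x∣≡∣p∣ j∈F∖i) ⟩
    2 ℕ.* m ℕ.+ suc ∣ F ∖ i ∣            ≡⟨ cong (ℕ._+_ (2 ℕ.* m)) (x∈p⇒suc∣p-x∣≡∣p∣ i∈F) ⟩
    2 ℕ.* m ℕ.+ ∣ F ∣                    ≡⟨ free-size ⟩
    n                                    ∎
    where
    open ≡-Reasoning
    j∈F∖i = x∈p∧x≢y⇒x∈p-y j∈F (≢-sym i≢j)

extend? : (x : Vec Trit n) {xs : Vec (Vec Trit n) m} → Matching xs → Maybe (Matching (x ∷ xs))
extend? x M = Maybe.zipWith (extend M) (find t1 (Matching.free M) x) (find t-1 (Matching.free M) x)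

greedy : (xs : Vec (Vec Trit n) m) → Maybe (Matching xs)
greedy []       = just emptyMatching
greedy (x ∷ xs) = greedy xs >>= extend? x

fails : Vec (Vec Trit n) m → ℚ
fails xs = 𝟙 (is-nothing (greedy xs))

is-nothing-map : ∀ (f : A → B) (a : Maybe A) → is-nothing (Maybe.map f a) ≡ is-nothing a
is-nothing-map f nothing  = refl
is-nothing-map f (just _) = refl

𝟙-is-nothing-zipWith : ∀ (f : A → B → C) a b →
                       𝟙 (is-nothing (Maybe.zipWith f a b)) ≤ 𝟙 (is-nothing a) + 𝟙 (is-nothing b)
𝟙-is-nothing-zipWith f nothing  b        = p≤p+q (𝟙-nonNeg (is-nothing b))
𝟙-is-nothing-zipWith f (just _) nothing  = ℚP.≤-refl
𝟙-is-nothing-zipWith f (just _) (just _) = ℚP.≤-refl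

-- The product distribution μ_p

module Distribution (p : ℚ) where

  trits : List Trit
  trits = t0 ∷ t1 ∷ t-1 ∷ []

  𝔼-trit : (Trit → ℚ) → ℚ
  𝔼-trit = expect (μ p) trits

  𝔼-vec : ∀ n → (Vec Trit n → ℚ) → ℚ
  𝔼-vec n = expect (probVec p) (allVecs n)

  𝔼-tuple : ∀ m n → (Vec (Vec Trit n) m → ℚ) → ℚ
  𝔼-tuple m n = expect (probTuple p) (allTuples m n)

  𝔼-vec-suc : ∀ n f → 𝔼-vec (suc n) f ≡ 𝔼-vec n (λ v → 𝔼-trit (λ t → f (t ∷ v)))
  𝔼-vec-suc n = expect-product _∷_ (μ p) (probVec p) (probVec p) (λ _ _ → refl) trits (allVecs n)

  𝔼-tuple-suc : ∀ m n f → 𝔼-tuple (suc m) n f ≡ 𝔼-tuple m n (λ xs → 𝔼-vec n (λ x → f (x ∷ xs)))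
  𝔼-tuple-suc m n =
    expect-product _∷_ (probVec p) (probTuple p) (probTuple p) (λ _ _ → refl) (allVecs n) (allTuples m n)

  𝔼-trit-1 : 𝔼-trit (λ _ → 1ℚ) ≡ 1ℚ
  𝔼-trit-1 = solve 1 (λ p → (con 1ℚ :- (p :+ p)) :* con 1ℚ :+ (p :* con 1ℚ :+ (p :* con 1ℚ :+ con 0ℚ))
                           := con 1ℚ) refl p

  𝔼-vec-1 : ∀ n → 𝔼-vec n (λ _ → 1ℚ) ≡ 1ℚ
  𝔼-vec-1 zero    = refl
  𝔼-vec-1 (suc n) =
    trans (𝔼-vec-suc n _) (trans (expect-cong (probVec p) (allVecs n) (λ _ → 𝔼-trit-1)) (𝔼-vec-1 n))

  𝔼-tuple-1 : ∀ m n → 𝔼-tuple m n (λ _ → 1ℚ) ≡ 1ℚ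
  𝔼-tuple-1 zero    n = refl
  𝔼-tuple-1 (suc m) n =
    trans (𝔼-tuple-suc m n _)
          (trans (expect-cong (probTuple p) (allTuples m n) (λ _ → 𝔼-vec-1 n)) (𝔼-tuple-1 m n))

  Prob≡𝔼-tuple : ∀ m n {E} (d : Decidable E) → Prob p m n d ≡ 𝔼-tuple m n (λ xs → 𝟙 (does (d xs)))
  Prob≡𝔼-tuple m n d = sumℚ-filter≡expect-𝟙 (probTuple p) d (allTuples m n)

  𝔼-trit-≢ : ∀ t → 𝔼-trit (λ y → 𝟙 (not (does (y ≟ᵗ t)))) ≡ 1ℚ - μ p t
  𝔼-trit-≢ t0  = solve 1 (λ p → (con 1ℚ :- (p :+ p)) :* con 0ℚ :+ (p :* con 1ℚ :+ (p :* con 1ℚ :+ con 0ℚ))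
                              := con 1ℚ :- (con 1ℚ :- (p :+ p))) refl p
  𝔼-trit-≢ t1  = solve 1 (λ p → (con 1ℚ :- (p :+ p)) :* con 1ℚ :+ (p :* con 0ℚ :+ (p :* con 1ℚ :+ con 0ℚ))
                              := con 1ℚ :- p) refl p
  𝔼-trit-≢ t-1 = solve 1 (λ p → (con 1ℚ :- (p :+ p)) :* con 1ℚ :+ (p :* con 1ℚ :+ (p :* con 0ℚ :+ con 0ℚ))
                              := con 1ℚ :- p) refl p

  𝔼-find-fails : ∀ t (A : Subset n) →
                 𝔼-vec n (λ x → 𝟙 (is-nothing (find t A x))) ≡ (1ℚ - μ p t) ^ℕ ∣ A ∣
  𝔼-find-fails t [] = refl
  𝔼-find-fails {suc n} t (outside ∷ A) = begin
    𝔼-vec (suc n) (λ x → 𝟙 (is-nothing (find t (outside ∷ A) x)))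
      ≡⟨ 𝔼-vec-suc n _ ⟩
    𝔼-vec n (λ v → 𝔼-trit (λ y → 𝟙 (is-nothing (find t (outside ∷ A) (y ∷ v)))))
      ≡⟨ expect-cong (probVec p) (allVecs n) (λ v →
           trans (expect-cong (μ p) trits
                    (λ y → cong 𝟙 (is-nothing-map (occurrence-suc {a = outside} {y} {x = v}) (find t A v))))
                 (expect-const (μ p) trits 𝔼-trit-1 _)) ⟩
    𝔼-vec n (λ v → 𝟙 (is-nothing (find t A v)))
      ≡⟨ 𝔼-find-fails t A ⟩
    (1ℚ - μ p t) ^ℕ ∣ A ∣
      ∎
    where open ≡-Reasoning
  𝔼-find-fails {suc n} t (inside ∷ A) = begin
    𝔼-vec (suc n) (λ x → 𝟙 (is-nothing (find t (inside ∷ A) x)))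
      ≡⟨ 𝔼-vec-suc n _ ⟩
    𝔼-vec n (λ v → 𝔼-trit (λ y → 𝟙 (is-nothing (find t (inside ∷ A) (y ∷ v)))))
      ≡⟨ expect-cong (probVec p) (allVecs n) (λ v →
           trans (expect-cong (μ p) trits (λ y → factor y v)) (expect-*ʳ (μ p) trits avoids _)) ⟩
    𝔼-vec n (λ v → 𝔼-trit avoids * 𝟙 (is-nothing (find t A v)))
      ≡⟨ expect-*ˡ (probVec p) (allVecs n) (𝔼-trit avoids) (λ v → 𝟙 (is-nothing (find t A v))) ⟩
    𝔼-trit avoids * 𝔼-vec n (λ v → 𝟙 (is-nothing (find t A v)))
      ≡⟨ cong₂ _*_ (𝔼-trit-≢ t) (𝔼-find-fails t A) ⟩
    (1ℚ - μ p t) * (1ℚ - μ p t) ^ℕ ∣ A ∣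
      ∎
    where
    open ≡-Reasoning
    avoids : Trit → ℚ
    avoids y = 𝟙 (not (does (y ≟ᵗ t)))
    factor : ∀ y v → 𝟙 (is-nothing (find t (inside ∷ A) (y ∷ v)))
                   ≡ avoids y * 𝟙 (is-nothing (find t A v))
    factor y v with y ≟ᵗ t
    ... | yes _ = sym (ℚP.*-zeroˡ (𝟙 (is-nothing (find t A v))))
    ... | no  _ = trans (cong 𝟙 (is-nothing-map (occurrence-suc {a = inside} {y} {x = v}) (find t A v)))
                        (sym (ℚP.*-identityˡ (𝟙 (is-nothing (find t A v)))))

  failure : ℕ → ℕ → ℚ
  failure m n = 𝔼-tuple m n fails

  module _ (0≤p : 0ℚ ≤ p) (p≤½ : p ≤ ½) where

    q : ℚ
    q = 1ℚ - p

    p≤1 : p ≤ 1ℚ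
    p≤1 = ℚP.≤-trans p≤½ (ℚP.≤ᵇ⇒≤ _)

    0≤q : 0ℚ ≤ q
    0≤q = p≤q⇒0≤q-p p≤1

    0<q : 0ℚ < q
    0<q = ℚP.<-≤-trans (ℚP.positive⁻¹ ½) (ℚP.+-monoʳ-≤ 1ℚ (ℚP.neg-antimono-≤ p≤½))

    q≤1 : q ≤ 1ℚ
    q≤1 = ℚP.+-monoʳ-≤ 1ℚ (ℚP.neg-antimono-≤ 0≤p)

    μ-nonNeg : ∀ t → 0ℚ ≤ μ p t
    μ-nonNeg t0  = p≤q⇒0≤q-p (ℚP.+-mono-≤ p≤½ p≤½)
    μ-nonNeg t1  = 0≤p
    μ-nonNeg t-1 = 0≤p

    probVec-nonNeg : (x : Vec Trit n) → 0ℚ ≤ probVec p x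
    probVec-nonNeg []      = ℚP.≤ᵇ⇒≤ _
    probVec-nonNeg (t ∷ x) = 0≤* (μ-nonNeg t) (probVec-nonNeg x)

    probTuple-nonNeg : (xs : Vec (Vec Trit n) m) → 0ℚ ≤ probTuple p xs
    probTuple-nonNeg []       = ℚP.≤ᵇ⇒≤ _
    probTuple-nonNeg (x ∷ xs) = 0≤* (probVec-nonNeg x) (probTuple-nonNeg xs)

    𝔼-vec-mono : ∀ n {f g} → (∀ x → f x ≤ g x) → 𝔼-vec n f ≤ 𝔼-vec n g
    𝔼-vec-mono n = expect-mono (probVec p) (allVecs n) probVec-nonNeg

    𝔼-tuple-mono : ∀ m n {f g} → (∀ xs → f xs ≤ g xs) → 𝔼-tuple m n f ≤ 𝔼-tuple m n g
    𝔼-tuple-mono m n = expect-mono (probTuple p) (allTuples m n) probTuple-nonNeg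

    𝔼-extend?-fails≤ : ∀ {xs : Vec (Vec Trit n) m} r → 2 ℕ.* m ℕ.+ r ≡ n → (g : Maybe (Matching xs)) →
                       𝔼-vec n (λ x → 𝟙 (is-nothing (g >>= extend? x)))
                         ≤ 𝟙 (is-nothing g) + (q ^ℕ r + q ^ℕ r)
    𝔼-extend?-fails≤ {n} r _ nothing = begin
      𝔼-vec n (λ _ → 1ℚ)    ≡⟨ 𝔼-vec-1 n ⟩
      1ℚ                    ≤⟨ p≤p+q (ℚP.+-mono-≤ (^ℕ-nonNeg 0≤q r) (^ℕ-nonNeg 0≤q r)) ⟩
      1ℚ + (q ^ℕ r + q ^ℕ r) ∎
      where open ℚP.≤-Reasoning
    𝔼-extend?-fails≤ {n} {m} r size (just M) = begin
      𝔼-vec n (λ x → 𝟙 (is-nothing (extend? x M)))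
        ≤⟨ 𝔼-vec-mono n (λ x → 𝟙-is-nothing-zipWith (extend {x = x} M) (find t1 F x) (find t-1 F x)) ⟩
      𝔼-vec n (λ x → 𝟙 (is-nothing (find t1 F x)) + 𝟙 (is-nothing (find t-1 F x)))
        ≡⟨ expect-+ (probVec p) (allVecs n) (λ x → 𝟙 (is-nothing (find t1 F x)))
                                             (λ x → 𝟙 (is-nothing (find t-1 F x))) ⟩
      𝔼-vec n (λ x → 𝟙 (is-nothing (find t1 F x))) + 𝔼-vec n (λ x → 𝟙 (is-nothing (find t-1 F x)))
        ≡⟨ cong₂ _+_ (𝔼-find-fails t1 F) (𝔼-find-fails t-1 F) ⟩
      q ^ℕ ∣ F ∣ + q ^ℕ ∣ F ∣
        ≡⟨ cong (λ k → q ^ℕ k + q ^ℕ k) ∣F∣≡r ⟩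
      q ^ℕ r + q ^ℕ r
        ≡⟨ sym (ℚP.+-identityˡ _) ⟩
      0ℚ + (q ^ℕ r + q ^ℕ r)
        ∎
      where
      open ℚP.≤-Reasoning
      F = Matching.free M
      ∣F∣≡r : ∣ F ∣ ≡ r
      ∣F∣≡r = ℕP.+-cancelˡ-≡ (2 ℕ.* m) _ _ (trans (Matching.free-size M) (sym size))

    failure-suc≤ : ∀ m r → 2 ℕ.* m ℕ.+ r ≡ n →
                 failure (suc m) n ≤ failure m n + (q ^ℕ r + q ^ℕ r)
    failure-suc≤ {n} m r size = begin
      failure (suc m) n
        ≡⟨ 𝔼-tuple-suc m n fails ⟩
      𝔼-tuple m n (λ xs → 𝔼-vec n (λ x → fails (x ∷ xs)))
        ≤⟨ 𝔼-tuple-mono m n (λ xs → 𝔼-extend?-fails≤ r size (greedy xs)) ⟩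
      𝔼-tuple m n (λ xs → fails xs + c)
        ≡⟨ expect-+ (probTuple p) (allTuples m n) fails (λ _ → c) ⟩
      failure m n + 𝔼-tuple m n (λ _ → c)
        ≡⟨ cong (_+_ (failure m n)) (expect-const (probTuple p) (allTuples m n) (𝔼-tuple-1 m n) c) ⟩
      failure m n + c
        ∎
      where
      open ℚP.≤-Reasoning
      c = q ^ℕ r + q ^ℕ r

    -- The slack is p²y, as (1 - p)² + 2p(1 - p) = 1 - p².
    geometric-step : ∀ {y} → 0ℚ ≤ y → q * (q * y) + p * (q * y + q * y) ≤ y
    geometric-step {y} 0≤y = 0≤q-p⇒p≤q (subst (0ℚ ≤_) (sym slack) (0≤* 0≤p (0≤* 0≤p 0≤y)))
      where
      slack : y - (q * (q * y) + p * (q * y + q * y)) ≡ p * (p * y)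
      slack = solve 2 (λ p y → y :- ((con 1ℚ :- p) :* ((con 1ℚ :- p) :* y)
                                    :+ p :* ((con 1ℚ :- p) :* y :+ (con 1ℚ :- p) :* y))
                               := p :* (p :* y)) refl p y

    p*failure≤ : ∀ m r → 2 ℕ.* m ℕ.+ r ≡ n → p * failure m n ≤ q ^ℕ suc r
    p*failure≤ zero    r _    = ℚP.≤-trans (ℚP.≤-reflexive (ℚP.*-zeroʳ p)) (^ℕ-nonNeg 0≤q (suc r))
    p*failure≤ {n} (suc m) r size = begin
      p * failure (suc m) n
        ≤⟨ ℚP.*-monoˡ-≤-nonNeg p {{ℚ.nonNegative 0≤p}} (failure-suc≤ m (suc (suc r)) size′) ⟩
      p * (failure m n + c)
        ≡⟨ ℚP.*-distribˡ-+ p _ c ⟩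
      p * failure m n + p * c
        ≤⟨ ℚP.+-monoˡ-≤ (p * c) (p*failure≤ m (suc (suc r)) size′) ⟩
      q ^ℕ suc (suc (suc r)) + p * c
        ≤⟨ geometric-step (^ℕ-nonNeg 0≤q (suc r)) ⟩
      q ^ℕ suc r
        ∎
      where
      open ℚP.≤-Reasoning
      c = q ^ℕ suc (suc r) + q ^ℕ suc (suc r)
      size′ = trans (sym (2[1+m]+r≡2m+[2+r] m r)) size

    p*failure≤1 : ∀ m n → p * failure m n ≤ 1ℚ
    p*failure≤1 m n = begin
      p * failure m n      ≤⟨ ℚP.*-monoˡ-≤-nonNeg p {{ℚ.nonNegative 0≤p}} failure≤1 ⟩
      p * 1ℚ                     ≡⟨ ℚP.*-identityʳ p ⟩
      p                          ≤⟨ p≤1 ⟩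
      1ℚ                         ∎
      where
      open ℚP.≤-Reasoning
      failure≤1 : failure m n ≤ 1ℚ
      failure≤1 = ℚP.≤-trans (𝔼-tuple-mono m n (λ xs → 𝟙≤1 (is-nothing (greedy xs))))
                           (ℚP.≤-reflexive (𝔼-tuple-1 m n))

    p*failure≤q^ℤ : ∀ m n → p * failure m n ≤ q ^ℤ ((+ n -ℤ (+ 2 *ℤ + m)) +ℤ + 1)
    p*failure≤q^ℤ m n with (+ n -ℤ (+ 2 *ℤ + m)) +ℤ + 1 in e
    ... | + zero   = p*failure≤1 m n
    ... | + suc r  = p*failure≤ m r (exponent-suc {m} e)
    ... | -[1+ k ] = ℚP.≤-trans (p*failure≤1 m n) (1≤^ℤ-[1+] 0<q q≤1 k)

    1≤Prob+failure : ∀ m n (d : Decidable (Event m n)) → 1ℚ ≤ Prob p m n d + failure m n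
    1≤Prob+failure m n d = begin
      1ℚ
        ≡⟨ sym (𝔼-tuple-1 m n) ⟩
      𝔼-tuple m n (λ _ → 1ℚ)
        ≤⟨ 𝔼-tuple-mono m n (λ xs → event-or-fails xs (greedy xs)) ⟩
      𝔼-tuple m n (λ xs → 𝟙 (does (d xs)) + fails xs)
        ≡⟨ expect-+ (probTuple p) (allTuples m n) (λ xs → 𝟙 (does (d xs))) fails ⟩
      𝔼-tuple m n (λ xs → 𝟙 (does (d xs))) + failure m n
        ≡⟨ cong (_+ failure m n) (sym (Prob≡𝔼-tuple m n d)) ⟩
      Prob p m n d + failure m n
        ∎
      where
      open ℚP.≤-Reasoning
      event-or-fails : ∀ xs (g : Maybe (Matching xs)) → 1ℚ ≤ 𝟙 (does (d xs)) + 𝟙 (is-nothing g)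
      event-or-fails xs g with d xs
      event-or-fails xs g        | yes _ = p≤p+q (𝟙-nonNeg (is-nothing g))
      event-or-fails xs nothing  | no _  = ℚP.≤-refl
      event-or-fails xs (just M) | no ¬E = ⊥-elim (¬E (matching⇒event M))

lemma4p5 : (p : ℚ) (0<p : 0ℚ < p) → p ≤ ½ → (m n : ℕ) → (d : Decidable (Event m n)) →
    1ℚ - _÷_ ((1ℚ - p) ^ℤ ((+ n -ℤ (+ 2 *ℤ + m)) +ℤ + 1)) p {{>-nonZero 0<p}} ≤ Prob p m n d
lemma4p5 p 0<p p≤½ m n d =
  p≤q+r∧r≤s⇒p-s≤q (1≤Prob+failure 0≤p p≤½ m n d)
                  (*≤⇒≤÷ p {{ℚ.positive 0<p}} (p*failure≤q^ℤ 0≤p p≤½ m n))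
  where
  open Distribution p
  0≤p = ℚP.<⇒≤ 0<p
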